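{- Let $n\ge 2$. The maximum weight of the Steinhaus triangles of size $n$ is $w_m=\lceil n(n+1)/3\rceil$. Moreover, with $\mathbf{z}_1=\overline{110}[n]$, $\mathbf{z}_2=\overline{011}[n]$, $\mathbf{z}_3=\overline{101}[n]$: (i) if $n\equiv 0,2\pmod 3$, then $W_m=\{\mathbf{z}_1,\mathbf{z}_2,\mathbf{z}_3\}$; (ii) if $n\equiv 1\pmod 3$, then $W_m=\{\mathbf{z}_1,\mathbf{z}_3\}$.
   Context: For $\mathbf{x}=(x_0,\ldots,x_{n-1})\in\mathbb{F}_2^n$, the derivative is $\partial\mathbf{x}=(x_0+x_1,\ldots,x_{n-2}+x_{n-1})\in\mathbb{F}_2^{n-1}$, with $\partial^0\mathbf{x}=\mathbf{x}$ and $\partial^i\mathbf{x}=\partial(\partial^{i-1}\mathbf{x})$. The Steinhaus triangle is $T(\mathbf{x})=(\mathbf{x},\partial\mathbf{x},\ldots,\partial^{n-1}\mathbf{x})$; $|\mathbf{y}|$ is the number of ones of a binary sequence and $|T(\mathbf{x})|=\sum_{i=0}^{n-1}|\partial^i\mathbf{x}|$. For fixed $n$, let $0=w_0<w_1<\cdots<w_m$ be the distinct values of $|T(\mathbf{x})|$ over $\mathbf{x}\in\mathbb{F}_2^n$ (so $w_m$ is the maximum), and $W_i=\{\mathbf{x}\in\mathbb{F}_2^n:|T(\mathbf{x})|=w_i\}$. $\overline{x_1\cdots x_p}[k]$ is the word of the first $k$ letters of the infinite periodic word $x_1\cdots x_px_1\cdots x_p\cdots$. -}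

module Defs where

open import Data.Bool using (Bool; true; false; _xor_)
open import Data.Nat using (ℕ; zero; suc; _+_; _*_; _/_)
open import Data.Vec using (Vec; []; _∷_)

-- binary sequences x ∈ F₂ⁿ are vectors of booleans (addition in F₂ is xor)

∂ : ∀ {n} → Vec Bool (suc n) → Vec Bool n
∂ (x ∷ []) = []
∂ (x ∷ y ∷ xs) = (x xor y) ∷ ∂ (y ∷ xs)

weight : ∀ {n} → Vec Bool n → ℕ
weight [] = 0
weight (true ∷ xs) = suc (weight xs)
weight (false ∷ xs) = weight xs

triangleWeight : ∀ {n} → Vec Bool n → ℕ
triangleWeight [] = 0
triangleWeight (x ∷ xs) = weight (x ∷ xs) + triangleWeight (∂ (x ∷ xs))

-- the periodic word  \overline{a b c}[n]  : first n letters of abcabc…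
periodic3 : Bool → Bool → Bool → (n : ℕ) → Vec Bool n
periodic3 a b c zero = []
periodic3 a b c (suc n) = a ∷ periodic3 b c a n

z₁ z₂ z₃ : (n : ℕ) → Vec Bool n
z₁ = periodic3 true true false
z₂ = periodic3 false true true
z₃ = periodic3 true false true

ceilThird : ℕ → ℕ
ceilThird m = (m + 2) / 3

-- Cut the triangle into bands of three rows: |T(x)| = |x| + |∂x| + |∂²x| + |T(∂³x)|.
-- The left edge of a band on a word starting p q r carries p, p + q and p + r; checking
-- the eight triples shows this column holds at most 2 ones, except for 1 0 0, whose
-- third one is paid for by the next band starting with 0 0.  Hence a band on a word of
-- length m + 2 has weight at most 2m + 2, and since ⌈(n+3)(n+4)/3⌉ = 2n + 4 + ⌈n(n+1)/3⌉
-- the bound follows in steps of 3.  The three rotations of 110… are fixed by ∂³ and fill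
-- every band, so their deficit from the bound depends only on n mod 3 (only 011… with
-- n ≡ 1 misses, by one).  Conversely, a maximal word has a full top band and a maximal
-- ∂³x, which by induction is a rotation of 110…; since the first letter of ∂³x is
-- x₀ + x₁ + x₂ + x₃, the word x itself is then that rotation, recovered letter by letter
-- from its tail.  Short words are settled by exhaustive computation.

module Submission where

open import Defs
open import Data.Bool using (Bool; true; false; _xor_)
open import Data.Bool.Properties using () renaming (_≟_ to _≟ᵇ_)
open import Data.Nat using (ℕ; zero; suc; _≤_; _<_; _*_; _+_; _/_; _%_; z≤n; s≤s)
open import Data.Nat.Properties
open import Data.Nat.DivMod using (+-distrib-/-∣ʳ; m*n/n≡m; m%n<n)
open import Data.Nat.Divisibility using (divides-refl)
open import Algebra.Properties.CommutativeSemigroup +-commutativeSemigroup using (x∙yz≈y∙xz)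
open import Data.Nat.Solver using (module +-*-Solver)
open import Data.Vec using (Vec; []; _∷_)
open import Data.Vec.Properties using (∷-injective; ≡-dec)
open import Data.Product using (_×_; Σ; _,_; proj₁; proj₂)
open import Data.Sum using (_⊎_; inj₁; inj₂)
import Data.Sum as Sum
open import Function.Bundles using (_⇔_; mk⇔)
open import Relation.Nullary using (Dec; contradiction; map′; _×-dec_; _⊎-dec_; _→-dec_)
open import Relation.Nullary.Decidable using (from-yes)
open import Relation.Binary.PropositionalEquality
open +-*-Solver

all? : ∀ n {P : Vec Bool n → Set} → (∀ x → Dec (P x)) → Dec (∀ x → P x)
all? zero    P? = map′ (λ { p [] → p }) (λ p → p []) (P? [])
all? (suc n) P? = map′ (λ { (p , q) (false ∷ xs) → p xs ; (p , q) (true ∷ xs) → q xs })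
                       (λ p → (λ xs → p (false ∷ xs)) , (λ xs → p (true ∷ xs)))
                       (all? n (λ xs → P? (false ∷ xs)) ×-dec all? n (λ xs → P? (true ∷ xs)))

bit : Bool → ℕ
bit true  = 1
bit false = 0

weight-∷ : ∀ {n} p (xs : Vec Bool n) → weight (p ∷ xs) ≡ bit p + weight xs
weight-∷ true  xs = refl
weight-∷ false xs = refl

∂³ : ∀ {n} → Vec Bool (3 + n) → Vec Bool n
∂³ x = ∂ (∂ (∂ x))

bandWeight : ∀ {m} → Vec Bool (2 + m) → ℕ
bandWeight x = weight x + (weight (∂ x) + weight (∂ (∂ x)))

triangleWeight-band : ∀ {n} (x : Vec Bool (3 + n)) → triangleWeight x ≡ bandWeight x + triangleWeight (∂³ x)
triangleWeight-band x@(_ ∷ _ ∷ _ ∷ _) =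
  solve 4 (λ a b c d → a :+ (b :+ (c :+ d)) := (a :+ (b :+ c)) :+ d) refl
    (weight x) (weight (∂ x)) (weight (∂ (∂ x))) (triangleWeight (∂³ x))

leadingColumn : Bool → Bool → Bool → ℕ
leadingColumn p q r = bit p + (bit (p xor q) + bit ((p xor q) xor (q xor r)))

bandWeight-∷ : ∀ {n} p q r (xs : Vec Bool n) →
  bandWeight (p ∷ q ∷ r ∷ xs) ≡ leadingColumn p q r + bandWeight (q ∷ r ∷ xs)
bandWeight-∷ p q r xs
  rewrite weight-∷ p (q ∷ r ∷ xs)
        | weight-∷ (p xor q) (∂ (q ∷ r ∷ xs))
        | weight-∷ ((p xor q) xor (q xor r)) (∂ (∂ (q ∷ r ∷ xs)))
  = solve 6 (λ a b c A B C → (a :+ A) :+ ((b :+ B) :+ (c :+ C)) := (a :+ (b :+ c)) :+ (A :+ (B :+ C)))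
      refl (bit p) (bit (p xor q)) (bit ((p xor q) xor (q xor r)))
      (weight (q ∷ r ∷ xs)) (weight (∂ (q ∷ r ∷ xs))) (weight (∂ (∂ (q ∷ r ∷ xs))))

doubleZero : Bool → Bool → ℕ
doubleZero false false = 1
doubleZero _     _     = 0

startsWithDoubleZero : ∀ {m} → Vec Bool (2 + m) → ℕ
startsWithDoubleZero (p ∷ q ∷ _) = doubleZero p q

leadingColumn-≤ : ∀ p q r → leadingColumn p q r + doubleZero p q ≤ 2 + doubleZero q r
leadingColumn-≤ true  true  true  = ≤ᵇ⇒≤ _ _ _
leadingColumn-≤ true  true  false = ≤ᵇ⇒≤ _ _ _
leadingColumn-≤ true  false true  = ≤ᵇ⇒≤ _ _ _
leadingColumn-≤ true  false false = ≤ᵇ⇒≤ _ _ _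
leadingColumn-≤ false true  true  = ≤ᵇ⇒≤ _ _ _
leadingColumn-≤ false true  false = ≤ᵇ⇒≤ _ _ _
leadingColumn-≤ false false true  = ≤ᵇ⇒≤ _ _ _
leadingColumn-≤ false false false = ≤ᵇ⇒≤ _ _ _

bandWeight-∷-≤ : ∀ {n} p q r (xs : Vec Bool n) →
  bandWeight (p ∷ q ∷ r ∷ xs) + doubleZero p q ≤ 2 + (bandWeight (q ∷ r ∷ xs) + doubleZero q r)
bandWeight-∷-≤ p q r xs = begin
  bandWeight (p ∷ q ∷ r ∷ xs) + c₁ ≡⟨ cong (_+ c₁) (bandWeight-∷ p q r xs) ⟩
  (l + b) + c₁                     ≡⟨ solve 3 (λ l b c₁ → (l :+ b) :+ c₁ := (l :+ c₁) :+ b) refl l b c₁ ⟩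
  (l + c₁) + b                     ≤⟨ +-monoˡ-≤ b (leadingColumn-≤ p q r) ⟩
  (2 + c₂) + b                     ≡⟨ solve 2 (λ c₂ b → (con 2 :+ c₂) :+ b := con 2 :+ (b :+ c₂)) refl c₂ b ⟩
  2 + (b + c₂)                     ∎
  where
  open ≤-Reasoning
  l = leadingColumn p q r
  b = bandWeight (q ∷ r ∷ xs)
  c₁ = doubleZero p q
  c₂ = doubleZero q r

bandBound : ℕ → ℕ
bandBound zero    = 2
bandBound (suc m) = 2 + bandBound m

bandWeight+doubleZero-≤ : ∀ m (x : Vec Bool (2 + m)) → bandWeight x + startsWithDoubleZero x ≤ bandBound m
bandWeight+doubleZero-≤ zero = from-yes (all? 2 λ x → bandWeight x + startsWithDoubleZero x ≤? 2)
bandWeight+doubleZero-≤ (suc m) (p ∷ q ∷ r ∷ xs) =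
  ≤-trans (bandWeight-∷-≤ p q r xs) (+-monoʳ-≤ 2 (bandWeight+doubleZero-≤ m (q ∷ r ∷ xs)))

bandWeight-≤ : ∀ m (x : Vec Bool (2 + m)) → bandWeight x ≤ bandBound m
bandWeight-≤ m x = ≤-trans (m≤m+n _ _) (bandWeight+doubleZero-≤ m x)

Saturated : ∀ {m} → Vec Bool (2 + m) → Set
Saturated {m} x = bandBound m ≤ bandWeight x + startsWithDoubleZero x

Saturated-tail : ∀ {n} p q r (xs : Vec Bool n) → Saturated (p ∷ q ∷ r ∷ xs) → Saturated (q ∷ r ∷ xs)
Saturated-tail p q r xs sat = +-cancelˡ-≤ 2 _ _ (≤-trans sat (bandWeight-∷-≤ p q r xs))

maxWeight : ℕ → ℕ
maxWeight n = ceilThird (n * (n + 1))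

bandBound≡ : ∀ m → bandBound m ≡ 2 + 2 * m
bandBound≡ zero    = refl
bandBound≡ (suc m) = cong (2 +_) (trans (bandBound≡ m) (sym (*-distribˡ-+ 2 1 m)))

maxWeight-+3 : ∀ n → maxWeight (3 + n) ≡ bandBound (suc n) + maxWeight n
maxWeight-+3 n = begin
  ((3 + n) * ((3 + n) + 1) + 2) / 3
    ≡⟨ cong (_/ 3) (solve 1 (λ n → (con 3 :+ n) :* ((con 3 :+ n) :+ con 1) :+ con 2
                                   := (n :* (n :+ con 1) :+ con 2) :+ (con 4 :+ con 2 :* n) :* con 3) refl n) ⟩
  ((n * (n + 1) + 2) + (4 + 2 * n) * 3) / 3
    ≡⟨ +-distrib-/-∣ʳ (n * (n + 1) + 2) (divides-refl (4 + 2 * n)) ⟩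
  maxWeight n + (4 + 2 * n) * 3 / 3
    ≡⟨ cong (maxWeight n +_) (m*n/n≡m (4 + 2 * n) 3) ⟩
  maxWeight n + (4 + 2 * n)
    ≡⟨ +-comm (maxWeight n) (2 + (2 + 2 * n)) ⟩
  2 + (2 + 2 * n) + maxWeight n
    ≡⟨ cong (λ b → 2 + b + maxWeight n) (bandBound≡ n) ⟨
  bandBound (suc n) + maxWeight n ∎
  where open ≡-Reasoning

triangleWeight-≤ : ∀ n (x : Vec Bool n) → triangleWeight x ≤ maxWeight n
triangleWeight-≤ 0 = from-yes (all? 0 λ x → triangleWeight x ≤? maxWeight 0)
triangleWeight-≤ 1 = from-yes (all? 1 λ x → triangleWeight x ≤? maxWeight 1)
triangleWeight-≤ 2 = from-yes (all? 2 λ x → triangleWeight x ≤? maxWeight 2)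
triangleWeight-≤ (suc (suc (suc n))) x = begin
  triangleWeight x                       ≡⟨ triangleWeight-band x ⟩
  bandWeight x + triangleWeight (∂³ x)   ≤⟨ +-mono-≤ (bandWeight-≤ (suc n) x) (triangleWeight-≤ n (∂³ x)) ⟩
  bandBound (suc n) + maxWeight n        ≡⟨ maxWeight-+3 n ⟨
  maxWeight (3 + n)                      ∎
  where open ≤-Reasoning

data Rotation110 : Bool → Bool → Bool → Set where
  r110 : Rotation110 true  true  false
  r011 : Rotation110 false true  true
  r101 : Rotation110 true  false true

rotate : ∀ {a b c} → Rotation110 a b c → Rotation110 b c a
rotate r110 = r101
rotate r011 = r110
rotate r101 = r011

∂-periodic3 : ∀ a b c n → ∂ (periodic3 a b c (suc n)) ≡ periodic3 (a xor b) (b xor c) (c xor a) n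
∂-periodic3 a b c zero    = refl
∂-periodic3 a b c (suc n) = cong ((a xor b) ∷_) (∂-periodic3 b c a n)

-- ∂ cycles the three words 110…, 011…, 101…
∂³-periodic3 : ∀ {a b c} → Rotation110 a b c → ∀ n → ∂³ (periodic3 a b c (3 + n)) ≡ periodic3 a b c n
∂³-periodic3 g n = cycle g
  where
  thrice : ∀ (x : Vec Bool (3 + n)) {y z w} → ∂ x ≡ y → ∂ y ≡ z → ∂ z ≡ w → ∂³ x ≡ w
  thrice x refl refl refl = refl
  cycle : ∀ {a b c} → Rotation110 a b c → ∂³ (periodic3 a b c (3 + n)) ≡ periodic3 a b c n
  cycle r110 = thrice (z₁ (3 + n)) (∂-periodic3 _ _ _ _) (∂-periodic3 _ _ _ _) (∂-periodic3 _ _ _ _)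
  cycle r011 = thrice (z₂ (3 + n)) (∂-periodic3 _ _ _ _) (∂-periodic3 _ _ _ _) (∂-periodic3 _ _ _ _)
  cycle r101 = thrice (z₃ (3 + n)) (∂-periodic3 _ _ _ _) (∂-periodic3 _ _ _ _) (∂-periodic3 _ _ _ _)

bandWeight-periodic3 : ∀ {a b c} → Rotation110 a b c → ∀ m → bandWeight (periodic3 a b c (2 + m)) ≡ bandBound m
bandWeight-periodic3 r110 zero = refl
bandWeight-periodic3 r011 zero = refl
bandWeight-periodic3 r101 zero = refl
bandWeight-periodic3 {a} {b} {c} g (suc m) =
  trans (bandWeight-∷ a b c (periodic3 a b c m))
        (cong₂ _+_ (leadingColumn-rotation g) (bandWeight-periodic3 (rotate g) m))
  where
  leadingColumn-rotation : ∀ {a b c} → Rotation110 a b c → leadingColumn a b c ≡ 2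
  leadingColumn-rotation r110 = refl
  leadingColumn-rotation r011 = refl
  leadingColumn-rotation r101 = refl

triangleWeight-periodic3 : ∀ {a b c} → Rotation110 a b c → ∀ n →
  triangleWeight (periodic3 a b c (3 + n)) ≡ bandBound (suc n) + triangleWeight (periodic3 a b c n)
triangleWeight-periodic3 {a} {b} {c} g n =
  trans (triangleWeight-band (periodic3 a b c (3 + n)))
        (cong₂ _+_ (bandWeight-periodic3 g (suc n)) (cong triangleWeight (∂³-periodic3 g n)))

periodic3-deficit : ∀ {a b c} → Rotation110 a b c → ∀ d n →
  d + triangleWeight (periodic3 a b c (n % 3)) ≡ maxWeight (n % 3) →
  d + triangleWeight (periodic3 a b c n) ≡ maxWeight n
periodic3-deficit g d 0 base = base
periodic3-deficit g d 1 base = base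
periodic3-deficit g d 2 base = base
periodic3-deficit {a} {b} {c} g d (suc (suc (suc n))) base = begin
  d + triangleWeight (periodic3 a b c (3 + n))   ≡⟨ cong (d +_) (triangleWeight-periodic3 g n) ⟩
  d + (bandBound (suc n) + w)                    ≡⟨ x∙yz≈y∙xz d (bandBound (suc n)) w ⟩
  bandBound (suc n) + (d + w)                    ≡⟨ cong (bandBound (suc n) +_) (periodic3-deficit g d n base) ⟩
  bandBound (suc n) + maxWeight n                ≡⟨ maxWeight-+3 n ⟨
  maxWeight (3 + n)                              ∎
  where
  open ≡-Reasoning
  w = triangleWeight (periodic3 a b c n)

-- the head of ∂³ (p ∷ b ∷ c ∷ a ∷ _) is p + b + c + a, and b + c = a on a rotation of 110
∂³-head-periodic3 : ∀ {a b c} → Rotation110 a b c → ∀ p →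
  ((p xor b) xor (b xor c)) xor ((b xor c) xor (c xor a)) ≡ a → p ≡ a
∂³-head-periodic3 r110 true  _ = refl
∂³-head-periodic3 r011 false _ = refl
∂³-head-periodic3 r101 true  _ = refl
∂³-head-periodic3 r110 false ()
∂³-head-periodic3 r011 true  ()
∂³-head-periodic3 r101 false ()

saturated-periodic3 : ∀ k {a b c} → Rotation110 a b c → (x : Vec Bool (5 + k)) →
  Saturated x → ∂³ x ≡ periodic3 a b c (2 + k) → x ≡ periodic3 a b c (5 + k)
-- 5 is the least length at which ∂³ x, of length 2, tells the three rotations apart
saturated-periodic3 zero g = length5 g
  where
  length5? : ∀ a b c (x : Vec Bool 5) → Dec (Saturated x → ∂³ x ≡ periodic3 a b c 2 → x ≡ periodic3 a b c 5)
  length5? a b c x = (_ ≤? _) →-dec ≡-dec _≟ᵇ_ _ _ →-dec ≡-dec _≟ᵇ_ _ _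
  length5 : ∀ {a b c} → Rotation110 a b c → ∀ x → Saturated x → ∂³ x ≡ periodic3 a b c 2 → x ≡ periodic3 a b c 5
  length5 r110 = from-yes (all? 5 (length5? true true false))
  length5 r011 = from-yes (all? 5 (length5? false true true))
  length5 r101 = from-yes (all? 5 (length5? true false true))
saturated-periodic3 (suc k) {a} {b} {c} g (p ∷ xs@(q ∷ r ∷ _ ∷ _)) sat ∂³x≡ with ∷-injective ∂³x≡
... | head≡ , tail≡ with saturated-periodic3 k (rotate g) xs (Saturated-tail p q r _ sat) tail≡
... | refl = cong (_∷ periodic3 b c a (5 + k)) (∂³-head-periodic3 g p head≡)

≤-+-≡⇒≡ : ∀ {a b c d} → a ≤ c → b ≤ d → a + b ≡ c + d → a ≡ c × b ≡ d
≤-+-≡⇒≡ {a} {b} {c} {d} a≤c b≤d sum≡ = a≡c , +-cancelˡ-≡ a b d (trans sum≡ (cong (_+ d) (sym a≡c)))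
  where
  a≡c : a ≡ c
  a≡c = ≤-antisym a≤c (+-cancelʳ-≤ d c a (subst (_≤ a + d) sum≡ (+-monoʳ-≤ a b≤d)))

maximal⇒saturated : ∀ n (x : Vec Bool (3 + n)) → triangleWeight x ≡ maxWeight (3 + n) →
  Saturated x × triangleWeight (∂³ x) ≡ maxWeight n
maximal⇒saturated n x tw≡
  with ≤-+-≡⇒≡ (bandWeight-≤ (suc n) x) (triangleWeight-≤ n (∂³ x))
                (trans (sym (triangleWeight-band x)) (trans tw≡ (maxWeight-+3 n)))
... | band≡ , ∂³-maximal = ≤-trans (≤-reflexive (sym band≡)) (m≤m+n _ _) , ∂³-maximal

OneOfZ : ∀ n → Vec Bool n → Set
OneOfZ n x = x ≡ z₁ n ⊎ x ≡ z₂ n ⊎ x ≡ z₃ n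

OneOfZ? : ∀ {n} (x : Vec Bool n) → Dec (OneOfZ n x)
OneOfZ? x = ≡-dec _≟ᵇ_ _ _ ⊎-dec ≡-dec _≟ᵇ_ _ _ ⊎-dec ≡-dec _≟ᵇ_ _ _

maximal⇒OneOfZ : ∀ n → 2 ≤ n → (x : Vec Bool n) → triangleWeight x ≡ maxWeight n → OneOfZ n x
maximal⇒OneOfZ 0 ()
maximal⇒OneOfZ 1 (s≤s ())
maximal⇒OneOfZ 2 _ = from-yes (all? 2 λ x → (triangleWeight x ≟ maxWeight 2) →-dec OneOfZ? x)
maximal⇒OneOfZ 3 _ = from-yes (all? 3 λ x → (triangleWeight x ≟ maxWeight 3) →-dec OneOfZ? x)
maximal⇒OneOfZ 4 _ = from-yes (all? 4 λ x → (triangleWeight x ≟ maxWeight 4) →-dec OneOfZ? x)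
maximal⇒OneOfZ (suc (suc (suc (suc (suc k))))) _ x tw≡ =
  Sum.map (periodic r110) (Sum.map (periodic r011) (periodic r101))
    (maximal⇒OneOfZ (suc (suc k)) (s≤s (s≤s z≤n)) (∂³ x) (proj₂ saturated))
  where
  saturated = maximal⇒saturated (2 + k) x tw≡
  periodic : ∀ {a b c} → Rotation110 a b c → ∂³ x ≡ periodic3 a b c (2 + k) → x ≡ periodic3 a b c (5 + k)
  periodic g = saturated-periodic3 k g x (proj₁ saturated)

periodic3-maximal : ∀ {a b c} → Rotation110 a b c → a ≡ true → ∀ n → triangleWeight (periodic3 a b c n) ≡ maxWeight n
periodic3-maximal g a≡true n = periodic3-deficit g 0 n (residue g a≡true (n % 3) (m%n<n n 3))
  where
  residue : ∀ {a b c} → Rotation110 a b c → a ≡ true → ∀ r → r < 3 →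
    triangleWeight (periodic3 a b c r) ≡ maxWeight r
  residue g    _ 0 _ = refl
  residue r110 _ 1 _ = refl
  residue r101 _ 1 _ = refl
  residue r110 _ 2 _ = refl
  residue r101 _ 2 _ = refl
  residue r011 () _ _
  residue _    _ (suc (suc (suc _))) (s≤s (s≤s (s≤s ())))

z₂-maximal : ∀ n → n % 3 ≡ 0 ⊎ n % 3 ≡ 2 → triangleWeight (z₂ n) ≡ maxWeight n
z₂-maximal n (inj₁ n%3≡0) = periodic3-deficit r011 0 n (subst (λ r → triangleWeight (z₂ r) ≡ maxWeight r) (sym n%3≡0) refl)
z₂-maximal n (inj₂ n%3≡2) = periodic3-deficit r011 0 n (subst (λ r → triangleWeight (z₂ r) ≡ maxWeight r) (sym n%3≡2) refl)

z₂-not-maximal : ∀ n → n % 3 ≡ 1 → triangleWeight (z₂ n) ≢ maxWeight n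
z₂-not-maximal n n%3≡1 tw≡ = 1+n≢n (trans deficit (sym tw≡))
  where
  deficit : 1 + triangleWeight (z₂ n) ≡ maxWeight n
  deficit = periodic3-deficit r011 1 n (subst (λ r → 1 + triangleWeight (z₂ r) ≡ maxWeight r) (sym n%3≡1) refl)

maximal⇒z₁⊎z₃ : ∀ n → 2 ≤ n → n % 3 ≡ 1 → (x : Vec Bool n) → triangleWeight x ≡ maxWeight n → x ≡ z₁ n ⊎ x ≡ z₃ n
maximal⇒z₁⊎z₃ n 2≤n n%3≡1 x tw≡ with maximal⇒OneOfZ n 2≤n x tw≡
... | inj₁ x≡z₁        = inj₁ x≡z₁
... | inj₂ (inj₁ refl) = contradiction tw≡ (z₂-not-maximal n n%3≡1)
... | inj₂ (inj₂ x≡z₃) = inj₂ x≡z₃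

theorem7p9 : (n : ℕ) → 2 ≤ n →
    (Σ (Vec Bool n) (λ x → triangleWeight x ≡ ceilThird (n * (n + 1)))
      × ((x : Vec Bool n) → triangleWeight x ≤ ceilThird (n * (n + 1))))
    × ((n % 3 ≡ 0 ⊎ n % 3 ≡ 2) → (x : Vec Bool n) →
        (triangleWeight x ≡ ceilThird (n * (n + 1)))
          ⇔ (x ≡ z₁ n ⊎ x ≡ z₂ n ⊎ x ≡ z₃ n))
    × (n % 3 ≡ 1 → (x : Vec Bool n) →
        (triangleWeight x ≡ ceilThird (n * (n + 1)))
          ⇔ (x ≡ z₁ n ⊎ x ≡ z₃ n))
theorem7p9 n 2≤n = ((z₁ n , z₁-maximal) , triangleWeight-≤ n) , case-i , case-ii
  where
  z₁-maximal = periodic3-maximal r110 refl n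
  z₃-maximal = periodic3-maximal r101 refl n

  case-i : n % 3 ≡ 0 ⊎ n % 3 ≡ 2 → (x : Vec Bool n) → triangleWeight x ≡ maxWeight n ⇔ OneOfZ n x
  case-i n%3 x = mk⇔ (maximal⇒OneOfZ n 2≤n x) λ where
    (inj₁ refl)        → z₁-maximal
    (inj₂ (inj₁ refl)) → z₂-maximal n n%3
    (inj₂ (inj₂ refl)) → z₃-maximal

  case-ii : n % 3 ≡ 1 → (x : Vec Bool n) → triangleWeight x ≡ maxWeight n ⇔ (x ≡ z₁ n ⊎ x ≡ z₃ n)
  case-ii n%3≡1 x = mk⇔ (maximal⇒z₁⊎z₃ n 2≤n n%3≡1 x) λ where
    (inj₁ refl) → z₁-maximal
    (inj₂ refl) → z₃-maximal
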